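{- Let $\mathcal{M}_b$ be a bounded model specification with initial runtime state $S_0$, and assume: (i) the equations $E$ are terminating and confluent modulo the axioms $B$ on the ground terms reachable from $S_0$ by $\Rightarrow$, and all auxiliary defined functions used by the construction rules (graph-update helpers, task constructors, $\mathsf{simpB}$) are ground-sufficiently complete on those reachable arguments, so that post-step canonicalization yields a unique $E/B$-normal form; (ii) for each reference-task token in the task pool, the admissible value domain induced by the bounds and the identifier universe is finite, and the task interval stored in the token ranges over that domain without repetition. Then every $\Rightarrow$-derivation from $S_0$ is finite.
   Context: Runtime states are pairs $\langle\mathcal{C}\mid\phi\rangle$ where $\phi$ is a Boolean SMT constraint and $\mathcal{C}$ is a multiset (modulo associativity, commutativity, identity) of object records $\langle o:K\mid\mathrm{AS}\rangle$ and control tokens: a phase marker ($\mathsf{objectBuild}$ or $\mathsf{refBuild}$), a class-indexed identifier universe $\mathsf{allIds}(\mathit{os})$, a finite allocation list $\mathsf{freshIds}(\mathit{ol})$, $\mathsf{takenIds}(\mathit{TI})$, counters $\mathsf{missing}(K,n)$ and $\mathsf{need}(K,n)$, and a finite task list $\mathsf{refPool}(\mathit{rtList})$ of tasks $\mathsf{refIdx}(o,R,K',\mathit{curr},\mathit{REM})$ with natural numbers $\mathit{curr},\mathit{REM}$. The initial state $S_0$ for $\mathcal{M}_b$ has phase $\mathsf{objectBuild}$, a finite allocation list of identifiers bounded by the class upper bounds in $b$, and constraint $\mathsf{true}$. A step $S\Rightarrow S'$ applies one of the rules below by matching modulo $B$, then normalizes the configuration by $E$ modulo $B$ and replaces $\phi$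 by $\mathsf{simpB}(\phi\wedge h)$ for a rule-specific hook constraint $h$ ($\mathsf{simpB}$ a deterministic Boolean simplifier). Rules: Obj-Gen consumes the head identifier of the allocation list, creates a new object, decrements $\mathsf{missing}$/$\mathsf{need}$ counters (saturating), and enqueues one reference task per role of the new object's class; Obj-Skip drops the head identifier of the allocation list (only when the corresponding $\mathsf{missing}$ and $\mathsf{need}$ counters are 0); when the allocation list is empty the phase changes to $\mathsf{refBuild}$ with the universe restricted to allocated identifiers; Ref-Choose removes the head task and commits its $\mathit{curr}$-th candidate value to the object's role attribute; Ref-Skip, when $\mathit{REM}>0$, replaces the head task $\mathsf{refIdx}(o,R,K',\mathit{curr},\mathit{REM})$ by $\mathsf{refIdx}(o,R,K',\mathit{curr}+1,\mathit{REM}-1)$. -}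

module Defs where

open import Level using (0ℓ)
open import Data.Nat using (ℕ; zero; suc; _+_; _∸_; _≤_; _<_)
open import Data.Bool using (if_then_else_)
open import Data.Maybe using (Maybe; just; nothing)
open import Data.Product using (_×_; _,_; proj₁; proj₂)
open import Data.List using (List; []; _∷_; _++_; map; filter; length)
open import Data.List.Membership.Propositional using (_∈_)
open import Data.List.Relation.Unary.Any using (any?)
open import Data.List.Relation.Unary.Unique.Propositional using (Unique)
open import Relation.Binary.Definitions using (DecidableEquality)
open import Relation.Binary.PropositionalEquality using (_≡_)
open import Relation.Binary.Construct.Closure.ReflexiveTransitive using (Star)
open import Relation.Nullary.Decidable using (⌊_⌋)
open import Function using (flip)
open import Induction.WellFounded using (Acc)

_‼_ : {A : Set} → List A → ℕ → Maybe A
[]       ‼ _       = nothing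
(x ∷ xs) ‼ zero    = just x
(x ∷ xs) ‼ (suc n) = xs ‼ n

-- A bounded model specification M_b, together with the auxiliary
-- (total, deterministic) functions used by the construction rules.
record Spec : Set₁ where
  field
    Cls Oid Role Val Attrs Φ : Set
    _≟C_ : DecidableEquality Cls
    _≟O_ : DecidableEquality Oid
    roles     : Cls → List (Role × Cls)
    initAttrs : Cls → Attrs
    setAttr   : Attrs → Role → Val → Attrs
    -- admissible value domain of a role with target class K',
    -- induced by the bounds and the (class-indexed) identifier universe
    dom       : List (Cls × Oid) → Cls → List Val
    initCurr  : Oid → Cls → Role → Cls → ℕ
    initREM   : Oid → Cls → Role → Cls → ℕ
    trueΦ     : Φ
    _∧Φ_      : Φ → Φ → Φ
    simpB     : Φ → Φ
    hGen      : Oid → Cls → Φ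
    hObjSkip  : Oid → Cls → Φ
    hPhase    : Φ
    hChoose   : Oid → Role → Cls → Val → Φ
    hRefSkip  : Oid → Role → Cls → ℕ → ℕ → Φ
    ub        : Cls → ℕ
    alloc₀    : List (Cls × Oid)
    alloc-bounded : ∀ K → length (filter (λ p → K ≟C proj₁ p) alloc₀) ≤ ub K
    univ₀     : List (Cls × Oid)
    missing₀  : Cls → ℕ
    need₀     : Cls → ℕ

module Runtime (M : Spec) where
  open Spec M

  data Phase : Set where
    objectBuild refBuild : Phase

  record Obj : Set where
    constructor ⟨_∶_∣_⟩
    field
      oid   : Oid
      cls   : Cls
      attrs : Attrs

  record Task : Set where
    constructor refIdx
    field
      tobj : Oid
      trole : Role
      ttgt : Cls
      curr : ℕ
      REM  : ℕ
  open Task public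

  -- runtime state ⟨ C | φ ⟩ (the configuration multiset is represented by
  -- its canonical form: one field per kind of control token)
  record State : Set where
    field
      phase   : Phase
      objects : List Obj
      allIds  : List (Cls × Oid)
      freshIds : List (Cls × Oid)
      takenIds : List Oid
      missing : Cls → ℕ
      need    : Cls → ℕ
      refPool : List Task
      φ       : Φ
  open State public

  decr : Cls → (Cls → ℕ) → Cls → ℕ
  decr K f K' = if ⌊ K ≟C K' ⌋ then f K' ∸ 1 else f K'

  commit : Oid → Role → Val → List Obj → List Obj
  commit o R v = map (λ ob → if ⌊ o ≟O Obj.oid ob ⌋
                               then ⟨ Obj.oid ob ∶ Obj.cls ob ∣ setAttr (Obj.attrs ob) R v ⟩
                               else ob)

  restrict : List Oid → List (Cls × Oid) → List (Cls × Oid)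
  restrict TI = filter (λ p → any? (λ o → proj₂ p ≟O o) TI)

  tasksFor : Oid → Cls → List Task
  tasksFor o K = map (λ rk → refIdx o (proj₁ rk) (proj₂ rk)
                               (initCurr o K (proj₁ rk) (proj₂ rk))
                               (initREM o K (proj₁ rk) (proj₂ rk))) (roles K)

  infix 4 _⇒_
  data _⇒_ : State → State → Set where
    obj-gen : ∀ {S K o ol} → phase S ≡ objectBuild → freshIds S ≡ (K , o) ∷ ol →
      S ⇒ record S { objects  = objects S ++ (⟨ o ∶ K ∣ initAttrs K ⟩ ∷ [])
                   ; freshIds = ol
                   ; takenIds = o ∷ takenIds S
                   ; missing  = decr K (missing S)
                   ; need     = decr K (need S)
                   ; refPool  = refPool S ++ tasksFor o K
                   ; φ        = simpB (φ S ∧Φ hGen o K) }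
    obj-skip : ∀ {S K o ol} → phase S ≡ objectBuild → freshIds S ≡ (K , o) ∷ ol →
      missing S K ≡ 0 → need S K ≡ 0 →
      S ⇒ record S { freshIds = ol ; φ = simpB (φ S ∧Φ hObjSkip o K) }
    to-refBuild : ∀ {S} → phase S ≡ objectBuild → freshIds S ≡ [] →
      S ⇒ record S { phase  = refBuild
                   ; allIds = restrict (takenIds S) (allIds S)
                   ; φ      = simpB (φ S ∧Φ hPhase) }
    ref-choose : ∀ {S t ts v} → phase S ≡ refBuild → refPool S ≡ t ∷ ts →
      (dom (allIds S) (ttgt t) ‼ curr t) ≡ just v →
      S ⇒ record S { objects = commit (tobj t) (trole t) v (objects S)
                   ; refPool = ts
                   ; φ       = simpB (φ S ∧Φ hChoose (tobj t) (trole t) (ttgt t) v) }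
    ref-skip : ∀ {S o R K' c r ts} → phase S ≡ refBuild →
      refPool S ≡ refIdx o R K' c (suc r) ∷ ts →
      S ⇒ record S { refPool = refIdx o R K' (suc c) r ∷ ts
                   ; φ       = simpB (φ S ∧Φ hRefSkip o R K' c (suc r)) }

  S₀ : State
  S₀ = record
    { phase = objectBuild ; objects = [] ; allIds = univ₀ ; freshIds = alloc₀
    ; takenIds = [] ; missing = missing₀ ; need = need₀ ; refPool = [] ; φ = trueΦ }

  Reachable : State → Set
  Reachable S = Star _⇒_ S₀ S

  TaskIntervalsOK : Set
  TaskIntervalsOK = ∀ S → Reachable S → ∀ t → t ∈ refPool S →
    (curr t + REM t < length (dom (allIds S) (ttgt t))) × Unique (dom (allIds S) (ttgt t))

  AllDerivationsFinite : State → Set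
  AllDerivationsFinite = Acc (flip _⇒_)

{-# OPTIONS --safe #-}
module Submission where

-- Lexicographic descent.  While objects are being built, every step removes the
-- head of the finite allocation list, and the only other move leaves the phase
-- for good.  While references are being built, every step lowers the pending
-- work Σ (1 + REM) of the task pool: Ref-Choose deletes a task and Ref-Skip
-- lowers its REM.  Neither the size of the value domains nor hypothesis (ii)
-- plays any role, since a skip never increases REM.

open import Defs
open import Data.Empty using (⊥; ⊥-elim)
open import Data.List using (List; length; map)
open import Data.Nat.ListAction using (sum)
open import Data.Nat using (ℕ; suc; _<_; s≤s)
open import Data.Nat.Induction using (<-wellFounded)
open import Data.Nat.Properties using (n<1+n; m≤n+m; +-monoˡ-<)
open import Data.Product using (_×_; _,_)
open import Data.Sum using (_⊎_; inj₁; inj₂)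
open import Function using (flip)
open import Induction.WellFounded using (Acc; acc)
open import Level using (0ℓ)
open import Relation.Binary.Core using (Rel)
open import Relation.Binary.PropositionalEquality using (_≡_; _≢_; refl; sym; trans)

module _ {A : Set} (_⟶_ : Rel A 0ℓ) (P Q : A → Set) (measure : A → ℕ)
         (Q-acc : ∀ {y} → Q y → Acc (flip _⟶_) y)
         (P-step : ∀ {x y} → P x → x ⟶ y → Q y ⊎ (P y × measure y < measure x))
         where

  acc-by-descent : ∀ {x} → P x → Acc (flip _⟶_) x
  acc-by-descent {x} px = go px (<-wellFounded (measure x))
    where
    go : ∀ {x} → P x → Acc _<_ (measure x) → Acc (flip _⟶_) x
    go {x} px (acc rs) = acc λ x⟶y → descend (P-step px x⟶y)
      where
      descend : ∀ {y} → Q y ⊎ (P y × measure y < measure x) → Acc (flip _⟶_) y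
      descend (inj₁ qy)        = Q-acc qy
      descend (inj₂ (py , lt)) = go py (rs lt)

module Termination (M : Spec) where
  open Runtime M

  pendingWork : List Task → ℕ
  pendingWork ts = sum (map (λ t → suc (REM t)) ts)

  objectBuild≢refBuild : objectBuild ≢ refBuild
  objectBuild≢refBuild ()

  refBuild-step : ∀ {S S′} → phase S ≡ refBuild → S ⇒ S′ →
                  phase S′ ≡ refBuild × pendingWork (refPool S′) < pendingWork (refPool S)
  refBuild-step p (obj-gen q _)      = ⊥-elim (objectBuild≢refBuild (trans (sym q) p))
  refBuild-step p (obj-skip q _ _ _) = ⊥-elim (objectBuild≢refBuild (trans (sym q) p))
  refBuild-step p (to-refBuild q _)  = ⊥-elim (objectBuild≢refBuild (trans (sym q) p))
  refBuild-step p (ref-choose {t = t} {ts} _ eq _) rewrite eq =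
    p , s≤s (m≤n+m (pendingWork ts) (REM t))
  refBuild-step p (ref-skip {r = r} {ts = ts} _ eq) rewrite eq =
    p , +-monoˡ-< (pendingWork ts) (n<1+n (suc r))

  objectBuild-step : ∀ {S S′} → phase S ≡ objectBuild → S ⇒ S′ →
                     phase S′ ≡ refBuild
                     ⊎ (phase S′ ≡ objectBuild × length (freshIds S′) < length (freshIds S))
  objectBuild-step p (obj-gen _ eq) rewrite eq      = inj₂ (p , n<1+n _)
  objectBuild-step p (obj-skip _ eq _ _) rewrite eq = inj₂ (p , n<1+n _)
  objectBuild-step p (to-refBuild _ _)              = inj₁ refl
  objectBuild-step p (ref-choose q _ _) = ⊥-elim (objectBuild≢refBuild (trans (sym p) q))
  objectBuild-step p (ref-skip q _)     = ⊥-elim (objectBuild≢refBuild (trans (sym p) q))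

  refBuild-acc : ∀ {S} → phase S ≡ refBuild → AllDerivationsFinite S
  refBuild-acc = acc-by-descent _⇒_ (λ S → phase S ≡ refBuild) (λ _ → ⊥)
    (λ S → pendingWork (refPool S)) ⊥-elim (λ p step → inj₂ (refBuild-step p step))

  objectBuild-acc : ∀ {S} → phase S ≡ objectBuild → AllDerivationsFinite S
  objectBuild-acc = acc-by-descent _⇒_ (λ S → phase S ≡ objectBuild) (λ S → phase S ≡ refBuild)
    (λ S → length (freshIds S)) refBuild-acc objectBuild-step

lemma1 : (M : Spec) → Runtime.TaskIntervalsOK M → Runtime.AllDerivationsFinite M (Runtime.S₀ M)
lemma1 M _ = Termination.objectBuild-acc M refl
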